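{- Let $\Gamma_1=(V_1,E_1)$ and $\Gamma_2=(V_2,E_2)$ be loopless graphs with $V_1\cap V_2=\emptyset$ and $V_1\neq\emptyset\neq V_2$, let $\Gamma=\Gamma_1\vee\Gamma_2$ with vertex set $V=V_1\sqcup V_2$, and let $u\in V$. Let $\alpha\in\mathrm{Nil}_k(\Gamma)$. Then there exists $\beta\in\mathrm{Nil}_k(\Gamma)$ such that $\beta$ is $u$-centred and $\mathrm{mon}(\beta)\preccurlyeq_u\mathrm{mon}(\alpha)$.
   Context: The join $\Gamma_1\vee\Gamma_2$ is the disjoint union plus an edge between each vertex of $V_1$ and each vertex of $V_2$. Write $n_i=|V_i|$. An animation of a graph $\Gamma=(V,E)$ is a partial function $\alpha:V\dashrightarrow V$ with $v^\alpha\sim v$ for all $v\in\mathrm{Dom}(\alpha)$; it is nilpotent if some iterate $\alpha^m$ ($m\ge1$) is nowhere defined; $\mathrm{Nil}_k(\Gamma)$ denotes nilpotent animations with $|\mathrm{Dom}(\alpha)|=k$; $\mathrm{mon}(\alpha)=\prod_{v\in\mathrm{Dom}(\alpha)}X_{v^\alpha}$. For $u\in V_i$ and $\{i,j\}=\{1,2\}$, $\alpha\in\mathrm{Nil}_k(\Gamma)$ is $u$-centred if $|V_j\cap\mathrm{Dom}(\alpha)|=\min(k,n_j)$ and $v^\alpha=u$ for all $v\in V_j\cap\mathrm{Dom}(\alpha)$. Let $\mathscr C_uV=\{x\in\mathbf R_{\ge0}V: x_u\le x_v\text{ for all }v\in V\}$; for $a,b\in\mathbf ZV$, $a\preccurlyeq_u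 b$ iff $(b-a)\cdot x\ge0$ for all $x\in\mathscr C_uV$ (standard inner product); for Laurent monomials, $X_V^a\preccurlyeq_u X_V^b$ iff $a\preccurlyeq_u b$.
   Formalization: The points of the cone $\mathscr C_uV$ defining $\preccurlyeq_u$ have rational coordinates instead of real ones. -}

module Defs where

open import Data.Nat using (ℕ; zero; suc; _⊓_; _≤_)
open import Data.Fin using (Fin)
open import Data.Fin.Properties using () renaming (_≟_ to _≟F_)
open import Data.List using (List; []; _∷_; map; _++_; allFin)
open import Data.Sum using (_⊎_; inj₁; inj₂)
open import Data.Sum.Properties using (≡-dec)
open import Data.Maybe using (Maybe; just; nothing; _>>=_)
open import Data.Bool using (Bool; true; false)
open import Data.Product using (Σ; _×_; _,_; proj₁)
open import Data.Unit using (⊤)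
open import Data.Empty using (⊥)
open import Relation.Nullary using (¬_; Dec; yes; no)
open import Relation.Binary.PropositionalEquality using (_≡_)
import Data.Integer as ℤ
open import Data.Rational as ℚ using (ℚ; 0ℚ; _/_)

record Graph (n : ℕ) : Set₁ where
  field
    Adj : Fin n → Fin n → Set
    Adj-sym : ∀ {x y} → Adj x y → Adj y x
open Graph public

Loopless : ∀ {n} → Graph n → Set
Loopless Γ = ∀ x → ¬ Adj Γ x x

V : ℕ → ℕ → Set
V n₁ n₂ = Fin n₁ ⊎ Fin n₂

JoinAdj : ∀ {n₁ n₂} → Graph n₁ → Graph n₂ → V n₁ n₂ → V n₁ n₂ → Set
JoinAdj Γ₁ Γ₂ (inj₁ a) (inj₁ b) = Adj Γ₁ a b
JoinAdj Γ₁ Γ₂ (inj₂ a) (inj₂ b) = Adj Γ₂ a b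
JoinAdj Γ₁ Γ₂ (inj₁ _) (inj₂ _) = ⊤
JoinAdj Γ₁ Γ₂ (inj₂ _) (inj₁ _) = ⊤

vertices : (n₁ n₂ : ℕ) → List (V n₁ n₂)
vertices n₁ n₂ = map inj₁ (allFin n₁) ++ map inj₂ (allFin n₂)

_≟V_ : ∀ {n₁ n₂} (x y : V n₁ n₂) → Dec (x ≡ y)
_≟V_ = ≡-dec _≟F_ _≟F_

count : ∀ {A : Set} → (A → Bool) → List A → ℕ
count p [] = zero
count p (x ∷ xs) with p x
... | true  = suc (count p xs)
... | false = count p xs

Animation : ∀ {n₁ n₂} → Graph n₁ → Graph n₂ → Set
Animation {n₁} {n₂} Γ₁ Γ₂ =
  Σ (V n₁ n₂ → Maybe (V n₁ n₂))
    (λ α → ∀ v w → α v ≡ just w → JoinAdj Γ₁ Γ₂ w v)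

iter : ∀ {A : Set} → (A → Maybe A) → ℕ → A → Maybe A
iter α zero    v = just v
iter α (suc m) v = iter α m v >>= α

NowhereDefined : ∀ {A : Set} → (A → Maybe A) → Set
NowhereDefined f = ∀ v → f v ≡ nothing

Nilpotent : ∀ {n₁ n₂} {Γ₁ : Graph n₁} {Γ₂ : Graph n₂} → Animation Γ₁ Γ₂ → Set
Nilpotent α = Σ ℕ (λ m → (1 ≤ m) × NowhereDefined (iter (proj₁ α) m))

defined : ∀ {A : Set} → Maybe A → Bool
defined (just _) = true
defined nothing  = false

domSize : ∀ {n₁ n₂} {Γ₁ : Graph n₁} {Γ₂ : Graph n₂} → Animation Γ₁ Γ₂ → ℕ
domSize {n₁} {n₂} α = count (λ v → defined (proj₁ α v)) (vertices n₁ n₂)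

Nil : ∀ {n₁ n₂} (Γ₁ : Graph n₁) (Γ₂ : Graph n₂) → ℕ → Animation Γ₁ Γ₂ → Set
Nil Γ₁ Γ₂ k α = Nilpotent α × domSize α ≡ k

-- mon(α) = ∏_{v ∈ Dom α} X_{v^α}, represented by its exponent vector
-- in ℕV ⊆ ℤV: the exponent of X_w is |{v ∈ Dom α : v^α = w}|.

hits : ∀ {n₁ n₂} → V n₁ n₂ → Maybe (V n₁ n₂) → Bool
hits w (just w') with w' ≟V w
... | yes _ = true
... | no  _ = false
hits w nothing = false

mon : ∀ {n₁ n₂} {Γ₁ : Graph n₁} {Γ₂ : Graph n₂} → Animation Γ₁ Γ₂ → V n₁ n₂ → ℕ
mon {n₁} {n₂} α w = count (λ v → hits w (proj₁ α v)) (vertices n₁ n₂)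

-- The cone 𝒞_u V and the preorder ≼_u on exponent vectors.
-- (Points x of the cone are taken with rational coordinates.)

sumℚ : List ℚ → ℚ
sumℚ []       = 0ℚ
sumℚ (q ∷ qs) = q ℚ.+ sumℚ qs

ℕ→ℚ : ℕ → ℚ
ℕ→ℚ n = ℤ.+ n / 1

InCone : ∀ {n₁ n₂} → V n₁ n₂ → (V n₁ n₂ → ℚ) → Set
InCone u x = (∀ v → 0ℚ ℚ.≤ x v) × (∀ v → x u ℚ.≤ x v)

_≼[_]_ : ∀ {n₁ n₂} → (V n₁ n₂ → ℕ) → V n₁ n₂ → (V n₁ n₂ → ℕ) → Set
_≼[_]_ {n₁} {n₂} a u b =
  ∀ (x : V n₁ n₂ → ℚ) → InCone u x →
    0ℚ ℚ.≤ sumℚ (map (λ v → (ℕ→ℚ (b v) ℚ.- ℕ→ℚ (a v)) ℚ.* x v) (vertices n₁ n₂))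

Centred : ∀ {n₁ n₂} {Γ₁ : Graph n₁} {Γ₂ : Graph n₂} →
          V n₁ n₂ → ℕ → Animation Γ₁ Γ₂ → Set
Centred {n₁} {n₂} (inj₁ u) k α =
  (count (λ v → defined (proj₁ α (inj₂ v))) (allFin n₂) ≡ k ⊓ n₂)
  × (∀ v w → proj₁ α (inj₂ v) ≡ just w → w ≡ inj₁ u)
Centred {n₁} {n₂} (inj₂ u) k α =
  (count (λ v → defined (proj₁ α (inj₁ v))) (allFin n₁) ≡ k ⊓ n₁)
  × (∀ v w → proj₁ α (inj₁ v) ≡ just w → w ≡ inj₂ u)

-- By the symmetry of the join we may take u = inj₁ u₀. The centred β sends min(k, n₂) vertices of
-- V₂ to u₀ and takes its other k ∸ n₂ arrows from the arrows of α starting in V₁, so mon β ≤ mon α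
-- away from u; as both monomials have degree k, (mon α − mon β)·x ≥ (k − k)·x_u = 0 on 𝒞_u V.
-- The arrows into u₀ could close a cycle: following α inside V₁ from u₀ ends at some p, and if α
-- sends p into V₂ that arrow is handed to a vertex of V₁ where α is undefined. Nilpotency provides
-- an undefined vertex; if it lies in V₂ the arrow at p is dropped instead, which is affordable since
-- then fewer than n₂ arrows of α start in V₂. A rank for β is the α-depth plus a penalty for the
-- vertices of V₁ outside the tree of p.

module Submission where

open import Defs
open import Data.Nat using (ℕ; zero; suc; _+_; _≤_; _<_; _⊓_; _∸_; z≤n; s≤s)
import Data.Nat.Properties as ℕ
import Data.Nat.Coprimality as Coprime
import Data.Nat.ListAction as List
import Data.Nat.ListAction.Properties as List
import Data.Integer as ℤ
import Data.Integer.Properties as ℤ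
open import Data.Rational as ℚ using (ℚ; 0ℚ; _/_; mkℚ)
import Data.Rational.Properties as ℚ
open import Data.Rational.Solver using (module +-*-Solver)
open import Algebra.Properties.Semiring.Sum ℕ.+-*-semiring
  using (∑-comm; ∑-permute; sum-cong-≗; sum-replicate-zero) renaming (sum to ∑)
open import Data.Fin using (Fin; zero; suc; splitAt)
open import Data.Fin.Properties using (_≟_)
import Data.Fin.Permutation as Perm
import Data.Fin.Permutation.Components as PC
open import Data.List using ([]; _∷_; map; _++_; allFin; tabulate)
open import Data.List.Properties using (map-++; map-tabulate)
open import Data.Sum using (_⊎_; inj₁; inj₂; swap; map₁)
open import Data.Sum.Properties using (swap-involutive)
open import Data.Maybe using (Maybe; just; nothing; _>>=_; maybe′)
import Data.Maybe as Maybe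
open import Data.Maybe.Properties using (just-injective)
open import Data.Bool using (Bool; true; false; if_then_else_)
open import Data.Product using (Σ; _×_; _,_; proj₁; proj₂)
open import Data.Unit using (tt)
open import Data.Empty using (⊥-elim)
open import Relation.Nullary using (does; yes; no)
open import Relation.Nullary.Decidable using (dec-true; dec-false)
open import Relation.Binary.PropositionalEquality
open import Function using (_∘_; const)

𝟙 : Bool → ℕ
𝟙 true  = 1
𝟙 false = 0

𝟙≤1 : ∀ b → 𝟙 b ≤ 1
𝟙≤1 true  = s≤s z≤n
𝟙≤1 false = z≤n

∑-mono-≤ : ∀ {n} {f g : Fin n → ℕ} → (∀ i → f i ≤ g i) → ∑ f ≤ ∑ g
∑-mono-≤ {zero}  f≤g = z≤n
∑-mono-≤ {suc n} f≤g = ℕ.+-mono-≤ (f≤g zero) (∑-mono-≤ (f≤g ∘ suc))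

∑-zero : ∀ {n} {f : Fin n → ℕ} → (∀ i → f i ≡ 0) → ∑ f ≡ 0
∑-zero {n} f≡0 = trans (sum-cong-≗ f≡0) (sum-replicate-zero n)

∑𝟙≤n : ∀ {n} (P : Fin n → Bool) → ∑ (𝟙 ∘ P) ≤ n
∑𝟙≤n {zero}  P = z≤n
∑𝟙≤n {suc n} P = ℕ.+-mono-≤ (𝟙≤1 (P zero)) (∑𝟙≤n (P ∘ suc))

∑𝟙<n : ∀ {n} (P : Fin n → Bool) {i} → P i ≡ false → ∑ (𝟙 ∘ P) < n
∑𝟙<n P {zero}  Pi≡false rewrite Pi≡false = s≤s (∑𝟙≤n (P ∘ suc))
∑𝟙<n P {suc i} Pi≡false = ℕ.+-mono-≤-< (𝟙≤1 (P zero)) (∑𝟙<n (P ∘ suc) Pi≡false)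

∑-ones : ∀ n → ∑ {n} (const 1) ≡ n
∑-ones zero    = refl
∑-ones (suc n) = cong suc (∑-ones n)

∑-δ : ∀ {n} (i : Fin n) → ∑ (λ j → 𝟙 (does (i ≟ j))) ≡ 1
∑-δ {suc n} zero    = cong suc (∑-zero {n} λ _ → refl)
∑-δ {suc n} (suc i) = ∑-δ i

∑V : ∀ {n₁ n₂} → (V n₁ n₂ → ℕ) → ℕ
∑V f = ∑ (f ∘ inj₁) + ∑ (f ∘ inj₂)

∑V-cong : ∀ {n₁ n₂} {f g : V n₁ n₂ → ℕ} → (∀ v → f v ≡ g v) → ∑V f ≡ ∑V g
∑V-cong f≗g = cong₂ _+_ (sum-cong-≗ (f≗g ∘ inj₁)) (sum-cong-≗ (f≗g ∘ inj₂))

∑V-mono-≤ : ∀ {n₁ n₂} {f g : V n₁ n₂ → ℕ} → (∀ v → f v ≤ g v) → ∑V f ≤ ∑V g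
∑V-mono-≤ f≤g = ℕ.+-mono-≤ (∑-mono-≤ (f≤g ∘ inj₁)) (∑-mono-≤ (f≤g ∘ inj₂))

∑V-swap : ∀ {n₁ n₂} (f : V n₂ n₁ → ℕ) → ∑V (f ∘ swap) ≡ ∑V f
∑V-swap f = ℕ.+-comm (∑ (f ∘ inj₂)) (∑ (f ∘ inj₁))

∑-splitAt : ∀ m {n} (f : V m n → ℕ) → ∑ (f ∘ splitAt m) ≡ ∑V f
∑-splitAt zero    f = refl
∑-splitAt (suc m) f = begin
  f (inj₁ zero) + ∑ (f ∘ map₁ suc ∘ splitAt m)         ≡⟨ cong (f (inj₁ zero) +_) (∑-splitAt m (f ∘ map₁ suc)) ⟩
  f (inj₁ zero) + (∑ (f ∘ inj₁ ∘ suc) + ∑ (f ∘ inj₂))  ≡⟨ ℕ.+-assoc (f (inj₁ zero)) _ _ ⟨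
  ∑V f                                                 ∎
  where open ≡-Reasoning

∑V-comm : ∀ {n₁ n₂} (F : V n₁ n₂ → V n₁ n₂ → ℕ) →
          ∑V (λ w → ∑V (F w)) ≡ ∑V (λ v → ∑V (λ w → F w v))
∑V-comm {n₁} F = begin
  ∑V (λ w → ∑V (F w))                                 ≡⟨ ∑-splitAt n₁ (λ w → ∑V (F w)) ⟨
  ∑ (λ i → ∑V (F (splitAt n₁ i)))                     ≡⟨ sum-cong-≗ (λ i → ∑-splitAt n₁ (F (splitAt n₁ i))) ⟨
  ∑ (λ i → ∑ (λ j → F (splitAt n₁ i) (splitAt n₁ j))) ≡⟨ ∑-comm (λ i j → F (splitAt n₁ i) (splitAt n₁ j)) ⟩
  ∑ (λ j → ∑ (λ i → F (splitAt n₁ i) (splitAt n₁ j))) ≡⟨ sum-cong-≗ (λ j → ∑-splitAt n₁ (λ w → F w (splitAt n₁ j))) ⟩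
  ∑ (λ j → ∑V (λ w → F w (splitAt n₁ j)))             ≡⟨ ∑-splitAt n₁ (λ v → ∑V (λ w → F w v)) ⟩
  ∑V (λ v → ∑V (λ w → F w v))                         ∎
  where open ≡-Reasoning

count≡sum : ∀ {A : Set} (P : A → Bool) xs → count P xs ≡ List.sum (map (𝟙 ∘ P) xs)
count≡sum P []       = refl
count≡sum P (x ∷ xs) with P x
... | true  = cong suc (count≡sum P xs)
... | false = count≡sum P xs

sum-map-tabulate : ∀ {A : Set} {n} (f : A → ℕ) (g : Fin n → A) → List.sum (map f (tabulate g)) ≡ ∑ (f ∘ g)
sum-map-tabulate {n = zero}  f g = refl
sum-map-tabulate {n = suc n} f g = cong (f (g zero) +_) (sum-map-tabulate f (g ∘ suc))

sum-map-vertices : ∀ {n₁ n₂} (f : V n₁ n₂ → ℕ) → List.sum (map f (vertices n₁ n₂)) ≡ ∑V f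
sum-map-vertices {n₁} {n₂} f = begin
  List.sum (map f (map inj₁ (allFin n₁) ++ map inj₂ (allFin n₂)))
    ≡⟨ cong List.sum (map-++ f (map inj₁ (allFin n₁)) _) ⟩
  List.sum (map f (map inj₁ (allFin n₁)) ++ map f (map inj₂ (allFin n₂)))
    ≡⟨ List.sum-++ (map f (map inj₁ (allFin n₁))) _ ⟩
  List.sum (map f (map inj₁ (allFin n₁))) + List.sum (map f (map inj₂ (allFin n₂)))
    ≡⟨ cong₂ _+_ (sum-map-tabulate-∘ inj₁) (sum-map-tabulate-∘ inj₂) ⟩
  ∑V f ∎
  where
  open ≡-Reasoning
  sum-map-tabulate-∘ : ∀ {n} (ι : Fin n → V n₁ n₂) → List.sum (map f (map ι (allFin n))) ≡ ∑ (f ∘ ι)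
  sum-map-tabulate-∘ ι = trans (cong (List.sum ∘ map f) (map-tabulate (λ i → i) ι)) (sum-map-tabulate f ι)

count-vertices : ∀ {n₁ n₂} (P : V n₁ n₂ → Bool) → count P (vertices n₁ n₂) ≡ ∑V (𝟙 ∘ P)
count-vertices P = trans (count≡sum P (vertices _ _)) (sum-map-vertices (𝟙 ∘ P))

count-allFin : ∀ {n} (P : Fin n → Bool) → count P (allFin n) ≡ ∑ (𝟙 ∘ P)
count-allFin P = trans (count≡sum P (allFin _)) (sum-map-tabulate (𝟙 ∘ P) (λ i → i))

hits-just : ∀ {n₁ n₂} (w y : V n₁ n₂) → hits w (just y) ≡ does (y ≟V w)
hits-just w y with y ≟V w
... | yes _ = refl
... | no  _ = refl

∑V-hits : ∀ {n₁ n₂} (m : Maybe (V n₁ n₂)) → ∑V (λ w → 𝟙 (hits w m)) ≡ 𝟙 (defined m)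
∑V-hits {n₁} {n₂} nothing = cong₂ _+_ (∑-zero {n₁} λ _ → refl) (∑-zero {n₂} λ _ → refl)
∑V-hits (just y) = trans (∑V-cong (λ w → cong 𝟙 (hits-just w y))) (∑V-δ y)
  where
  ∑V-δ : ∀ {n₁ n₂} (y : V n₁ n₂) → ∑V (λ w → 𝟙 (does (y ≟V w))) ≡ 1
  ∑V-δ {n₁} {n₂} (inj₁ a) = cong₂ _+_ (∑-δ a) (∑-zero {n₂} λ _ → refl)
  ∑V-δ {n₁} {n₂} (inj₂ b) = cong₂ _+_ (∑-zero {n₁} λ _ → refl) (∑-δ b)

sum-mon≡domSize : ∀ {n₁ n₂} {Γ₁ : Graph n₁} {Γ₂ : Graph n₂} (α : Animation Γ₁ Γ₂) →
                  List.sum (map (mon α) (vertices n₁ n₂)) ≡ domSize α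
sum-mon≡domSize {n₁} {n₂} α@(g , _) = begin
  List.sum (map (mon α) (vertices n₁ n₂))                 ≡⟨ sum-map-vertices (mon α) ⟩
  ∑V (λ w → count (λ v → hits w (g v)) (vertices n₁ n₂))  ≡⟨ ∑V-cong (λ w → count-vertices (λ v → hits w (g v))) ⟩
  ∑V (λ w → ∑V (λ v → 𝟙 (hits w (g v))))                  ≡⟨ ∑V-comm (λ w v → 𝟙 (hits w (g v))) ⟩
  ∑V (λ v → ∑V (λ w → 𝟙 (hits w (g v))))                  ≡⟨ ∑V-cong (∑V-hits ∘ g) ⟩
  ∑V (λ v → 𝟙 (defined (g v)))                            ≡⟨ count-vertices (defined ∘ g) ⟨
  count (defined ∘ g) (vertices n₁ n₂)                    ∎
  where open ≡-Reasoning

ℕ→ℚ-+ : ∀ m n → ℕ→ℚ (m + n) ≡ ℕ→ℚ m ℚ.+ ℕ→ℚ n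
ℕ→ℚ-+ m n = begin
  ℕ→ℚ (m + n)                                     ≡⟨ ℚ./-cong (cong₂ ℤ._+_ (ℤ.*-identityʳ (ℤ.+ m)) (ℤ.*-identityʳ (ℤ.+ n))) refl ⟨
  (ℤ.+ m ℤ.* ℤ.+ 1 ℤ.+ ℤ.+ n ℤ.* ℤ.+ 1) / 1       ≡⟨⟩
  mkℚ (ℤ.+ m) 0 m⊥1 ℚ.+ mkℚ (ℤ.+ n) 0 n⊥1         ≡⟨ cong₂ ℚ._+_ (ℚ.normalize-coprime m⊥1) (ℚ.normalize-coprime n⊥1) ⟨
  ℕ→ℚ m ℚ.+ ℕ→ℚ n                                 ∎
  where
  open ≡-Reasoning
  m⊥1 = Coprime.sym (Coprime.1-coprimeTo m)
  n⊥1 = Coprime.sym (Coprime.1-coprimeTo n)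

ℕ→ℚ-∸ : ∀ {m n} → n ≤ m → ℕ→ℚ (m ∸ n) ≡ ℕ→ℚ m ℚ.- ℕ→ℚ n
ℕ→ℚ-∸ {m} {n} n≤m = begin
  ℕ→ℚ (m ∸ n)                            ≡⟨ solve 2 (λ a d → d := (a :+ d) :- a) refl (ℕ→ℚ n) (ℕ→ℚ (m ∸ n)) ⟩
  (ℕ→ℚ n ℚ.+ ℕ→ℚ (m ∸ n)) ℚ.- ℕ→ℚ n      ≡⟨ cong (ℚ._- ℕ→ℚ n) (ℕ→ℚ-+ n (m ∸ n)) ⟨
  ℕ→ℚ (n + (m ∸ n)) ℚ.- ℕ→ℚ n            ≡⟨ cong (λ k → ℕ→ℚ k ℚ.- ℕ→ℚ n) (ℕ.m+[n∸m]≡n n≤m) ⟩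
  ℕ→ℚ m ℚ.- ℕ→ℚ n                        ∎
  where
  open ≡-Reasoning
  open +-*-Solver

ℕ→ℚ-nonNeg : ∀ n → 0ℚ ℚ.≤ ℕ→ℚ n
ℕ→ℚ-nonNeg n = ℚ.nonNegative⁻¹ (ℕ→ℚ n) {{ℚ.normalize-nonNeg n 1}}

_≤ᶜ[_]_ : ∀ {n₁ n₂} → (V n₁ n₂ → ℕ) → V n₁ n₂ → (V n₁ n₂ → ℕ) → Set
a ≤ᶜ[ u ] b = ∀ w → w ≢ u → a w ≤ b w

module _ {n₁ n₂} {u : V n₁ n₂} {a b : V n₁ n₂ → ℕ} (a≤b : a ≤ᶜ[ u ] b)
         (x : V n₁ n₂ → ℚ) (x-min : ∀ v → x u ℚ.≤ x v) where

  private
    Δ : V n₁ n₂ → ℚ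
    Δ v = ℕ→ℚ (b v) ℚ.- ℕ→ℚ (a v)

    Δ*min≤Δ* : ∀ v → Δ v ℚ.* x u ℚ.≤ Δ v ℚ.* x v
    Δ*min≤Δ* v with v ≟V u
    ... | yes refl = ℚ.≤-refl
    ... | no  v≢u  = ℚ.*-monoˡ-≤-nonNeg (Δ v) {{ℚ.nonNegative Δv≥0}} (x-min v)
      where
      Δv≥0 : 0ℚ ℚ.≤ Δ v
      Δv≥0 = subst (0ℚ ℚ.≤_) (ℕ→ℚ-∸ (a≤b v v≢u)) (ℕ→ℚ-nonNeg (b v ∸ a v))

  weighted-difference-≥ : ∀ L →
    (ℕ→ℚ (List.sum (map b L)) ℚ.- ℕ→ℚ (List.sum (map a L))) ℚ.* x u
      ℚ.≤ sumℚ (map (λ v → Δ v ℚ.* x v) L)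
  weighted-difference-≥ []      = ℚ.≤-reflexive (solve 1 (λ y → (con 0ℚ :- con 0ℚ) :* y := con 0ℚ) refl (x u))
    where open +-*-Solver
  weighted-difference-≥ (v ∷ L) = ℚ.≤-trans (ℚ.≤-reflexive split) (ℚ.+-mono-≤ (Δ*min≤Δ* v) (weighted-difference-≥ L))
    where
    open +-*-Solver
    B = List.sum (map b L)
    A = List.sum (map a L)
    split : (ℕ→ℚ (b v + B) ℚ.- ℕ→ℚ (a v + A)) ℚ.* x u ≡ Δ v ℚ.* x u ℚ.+ (ℕ→ℚ B ℚ.- ℕ→ℚ A) ℚ.* x u
    split rewrite ℕ→ℚ-+ (b v) B | ℕ→ℚ-+ (a v) A =
      solve 5 (λ p q r s y → ((p :+ q) :- (r :+ s)) :* y := (p :- r) :* y :+ (q :- s) :* y) refl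
        (ℕ→ℚ (b v)) (ℕ→ℚ B) (ℕ→ℚ (a v)) (ℕ→ℚ A) (x u)

≼-intro : ∀ {n₁ n₂} {u : V n₁ n₂} {a b : V n₁ n₂ → ℕ} → a ≤ᶜ[ u ] b →
          List.sum (map a (vertices n₁ n₂)) ≡ List.sum (map b (vertices n₁ n₂)) → a ≼[ u ] b
≼-intro {n₁} {n₂} {u} {a} {b} a≤b ∑a≡∑b x (_ , x-min) =
  ℚ.≤-trans (ℚ.≤-reflexive (sym zero-difference)) (weighted-difference-≥ a≤b x x-min (vertices n₁ n₂))
  where
  open +-*-Solver
  zero-difference : (ℕ→ℚ (List.sum (map b (vertices n₁ n₂))) ℚ.- ℕ→ℚ (List.sum (map a (vertices n₁ n₂)))) ℚ.* x u ≡ 0ℚ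
  zero-difference rewrite ∑a≡∑b = solve 2 (λ s y → (s :- s) :* y := con 0ℚ) refl (ℕ→ℚ (List.sum (map b (vertices n₁ n₂)))) (x u)

record Rank {A : Set} (g : A → Maybe A) (N : ℕ) : Set where
  field
    rank            : A → ℕ
    rank≤           : ∀ v → rank v ≤ N
    rank-decreasing : ∀ {v w} → g v ≡ just w → rank w < rank v

module _ {A : Set} (g : A → Maybe A) where

  iter-suc : ∀ m v → iter g (suc m) v ≡ (g v >>= iter g m)
  iter-suc zero v with g v
  ... | just _  = refl
  ... | nothing = refl
  iter-suc (suc m) v rewrite iter-suc m v with g v
  ... | just _  = refl
  ... | nothing = refl

  Rank⇒nowhereDefined : ∀ {N} → Rank g N → NowhereDefined (iter g (suc N))
  Rank⇒nowhereDefined {N} ρ v with iter g (suc N) v in orbit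
  ... | nothing = refl
  ... | just w  = ⊥-elim (ℕ.n≮n N (begin
    suc N              ≤⟨ ℕ.m≤n+m (suc N) (rank w) ⟩
    rank w + suc N     ≤⟨ descends (suc N) orbit ⟩
    rank v             ≤⟨ rank≤ v ⟩
    N                  ∎))
    where
    open Rank ρ
    open ℕ.≤-Reasoning
    descends : ∀ m {w} → iter g m v ≡ just w → rank w + m ≤ rank v
    descends zero    refl = ℕ.≤-reflexive (ℕ.+-identityʳ (rank v))
    descends (suc m) {w} orbit with iter g m v in orbit′
    ... | just y = begin
      rank w + suc m   ≡⟨ ℕ.+-suc (rank w) m ⟩
      suc (rank w) + m ≤⟨ ℕ.+-monoˡ-≤ m (rank-decreasing orbit) ⟩
      rank y + m       ≤⟨ descends m orbit′ ⟩
      rank v           ∎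

  nowhereDefined⇒Rank : ∀ {M} → NowhereDefined (iter g (suc M)) → Rank g (suc M)
  nowhereDefined⇒Rank {M} nd = record
    { rank = depth (suc M) ; rank≤ = depth≤ (suc M) ; rank-decreasing = decreasing }
    where
    depth : ℕ → A → ℕ
    depth zero    v = 0
    depth (suc n) v = maybe′ (suc ∘ depth n) 0 (g v)

    depth≤ : ∀ n v → depth n v ≤ n
    depth≤ zero    v = z≤n
    depth≤ (suc n) v with g v
    ... | just w  = s≤s (depth≤ n w)
    ... | nothing = z≤n

    depth-stable : ∀ n v → iter g n v ≡ nothing → depth (suc n) v ≡ depth n v
    depth-stable (suc n) v dies with g v in step
    ... | nothing = refl
    ... | just w  = cong suc (depth-stable n w (trans (sym (trans (iter-suc n v) (cong (_>>= iter g n) step))) dies))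

    decreasing : ∀ {v w} → g v ≡ just w → depth (suc M) w < depth (suc M) v
    decreasing {v} {w} step rewrite step =
      s≤s (ℕ.≤-reflexive (depth-stable M w (trans (sym (trans (iter-suc M v) (cong (_>>= iter g M) step))) (nd v))))

  Rank-⊆ : ∀ {N} {g′ : A → Maybe A} → (∀ {v w} → g′ v ≡ just w → g v ≡ just w) → Rank g N → Rank g′ N
  Rank-⊆ g′⊆g ρ = record { rank = rank ; rank≤ = rank≤ ; rank-decreasing = rank-decreasing ∘ g′⊆g }
    where open Rank ρ

  dies-somewhere : ∀ m v → iter g m v ≡ nothing → Σ A λ y → g y ≡ nothing
  dies-somewhere (suc m) v dies with iter g m v in orbit
  ... | nothing = dies-somewhere m v orbit
  ... | just y  = y , dies

restrict : ∀ {A B : Set} → (A → Bool) → (A → Maybe B) → A → Maybe B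
restrict keep g v = if keep v then g v else nothing

module _ {A B : Set} (keep : A → Bool) (g : A → Maybe B) where

  restrict-⊆ : ∀ v {w} → restrict keep g v ≡ just w → g v ≡ just w
  restrict-⊆ v with keep v
  ... | true  = λ gv≡w → gv≡w
  ... | false = λ ()

  restrict-≤ : (P : Maybe B → Bool) → P nothing ≡ false → ∀ v → 𝟙 (P (restrict keep g v)) ≤ 𝟙 (P (g v))
  restrict-≤ P P-nothing v with keep v
  ... | true  = ℕ.≤-refl
  ... | false rewrite P-nothing = z≤n

  defined-restrict : ∀ v → (keep v ≡ true → defined (g v) ≡ true) → defined (restrict keep g v) ≡ keep v
  defined-restrict v kept⇒defined with keep v
  ... | true  = kept⇒defined refl
  ... | false = refl

selectFirst : ℕ → ∀ {n} → (Fin n → Bool) → Fin n → Bool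
selectFirst zero    P i       = false
selectFirst (suc r) P zero    = P zero
selectFirst (suc r) P (suc i) = selectFirst (if P zero then r else suc r) (P ∘ suc) i

selectFirst⇒ : ∀ r {n} (P : Fin n → Bool) i → selectFirst r P i ≡ true → P i ≡ true
selectFirst⇒ (suc r) P zero    selected = selected
selectFirst⇒ (suc r) P (suc i) selected with P zero
... | true  = selectFirst⇒ r (P ∘ suc) i selected
... | false = selectFirst⇒ (suc r) (P ∘ suc) i selected

∑-selectFirst : ∀ r {n} (P : Fin n → Bool) → ∑ (𝟙 ∘ selectFirst r P) ≡ r ⊓ ∑ (𝟙 ∘ P)
∑-selectFirst zero    {n}     P = ∑-zero {n} λ _ → refl
∑-selectFirst (suc r) {zero}  P = refl
∑-selectFirst (suc r) {suc n} P with P zero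
... | true  = cong suc (∑-selectFirst r (P ∘ suc))
... | false = ∑-selectFirst (suc r) (P ∘ suc)

transpose-source : ∀ {n} (i j : Fin n) → PC.transpose i j i ≡ j
transpose-source i j rewrite dec-true (i ≟ i) refl = refl

transpose-≢ : ∀ {n} (i j : Fin n) {k} → k ≢ i → PC.transpose i j k ≡ k ⊎ (k ≡ j × PC.transpose i j k ≡ i)
transpose-≢ i j {k} k≢i rewrite dec-false (k ≟ i) k≢i with k ≟ j
... | yes refl = inj₂ (refl , refl)
... | no  _    = inj₁ refl

erase : ∀ {n} {A : Set} → Fin n → (Fin n → Maybe A) → Fin n → Maybe A
erase p g i = if does (i ≟ p) then nothing else g i

module _ {A : Set} where

  erase-⊆ : ∀ {n} (p : Fin n) (g : Fin n → Maybe A) {i w} → erase p g i ≡ just w → i ≢ p × g i ≡ just w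
  erase-⊆ p g {i} with i ≟ p
  ... | no i≢p = λ gi≡w → i≢p , gi≡w

  ∑-erase : (P : Maybe A → Bool) → P nothing ≡ false →
            ∀ {n} (p : Fin n) (g : Fin n → Maybe A) → ∑ (𝟙 ∘ P ∘ erase p g) + 𝟙 (P (g p)) ≡ ∑ (𝟙 ∘ P ∘ g)
  ∑-erase P P-nothing zero    g rewrite P-nothing = ℕ.+-comm (∑ (𝟙 ∘ P ∘ g ∘ suc)) (𝟙 (P (g zero)))
  ∑-erase P P-nothing (suc p) g =
    trans (ℕ.+-assoc (𝟙 (P (g zero))) _ _) (cong (𝟙 (P (g zero)) +_) (∑-erase P P-nothing p (g ∘ suc)))

-- z takes over the value of p, whose own value is erased; z's previous value is lost.
reassign : ∀ {n} {A : Set} → Fin n → Fin n → (Fin n → Maybe A) → Fin n → Maybe A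
reassign p z g = erase p (g ∘ PC.transpose p z)

module _ {n} {A : Set} (p z : Fin n) (g : Fin n → Maybe A) where

  reassign-⊆ : ∀ {i w} → reassign p z g i ≡ just w → i ≢ p × (g i ≡ just w ⊎ (i ≡ z × g p ≡ just w))
  reassign-⊆ {i} {w} reassigned with erase-⊆ p (g ∘ PC.transpose p z) reassigned
  ... | i≢p , g[τi]≡w with transpose-≢ p z i≢p
  ...   | inj₁ fixed         = i≢p , inj₁ (subst (λ k → g k ≡ just w) fixed g[τi]≡w)
  ...   | inj₂ (i≡z , moved) = i≢p , inj₂ (i≡z , subst (λ k → g k ≡ just w) moved g[τi]≡w)

  ∑-reassign : (P : Maybe A → Bool) → P nothing ≡ false →
               ∑ (𝟙 ∘ P ∘ reassign p z g) + 𝟙 (P (g z)) ≡ ∑ (𝟙 ∘ P ∘ g)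
  ∑-reassign P P-nothing = begin
    ∑ (𝟙 ∘ P ∘ reassign p z g) + 𝟙 (P (g z))      ≡⟨ cong (λ k → ∑ (𝟙 ∘ P ∘ reassign p z g) + 𝟙 (P (g k))) (transpose-source p z) ⟨
    ∑ (𝟙 ∘ P ∘ reassign p z g) + 𝟙 (P (g (τ p)))  ≡⟨ ∑-erase P P-nothing p (g ∘ τ) ⟩
    ∑ (𝟙 ∘ P ∘ g ∘ τ)                             ≡⟨ ∑-permute (𝟙 ∘ P ∘ g) (Perm.transpose p z) ⟨
    ∑ (𝟙 ∘ P ∘ g)                                 ∎
    where
    open ≡-Reasoning
    τ = PC.transpose p z

module CentredAtV₁ {n₁ n₂} {Γ₁ : Graph n₁} {Γ₂ : Graph n₂} (α : Animation Γ₁ Γ₂)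
  {L} (ρα : Rank (proj₁ α) L) (dead : V n₁ n₂) (dead-undefined : proj₁ α dead ≡ nothing)
  (u₀ : Fin n₁) (k : ℕ) (|α|≡k : domSize α ≡ k) where

  open Rank ρα

  f : V n₁ n₂ → Maybe (V n₁ n₂)
  f = proj₁ α

  f₁ : Fin n₁ → Maybe (V n₁ n₂)
  f₁ = f ∘ inj₁

  h : Fin n₁ → ℕ
  h = rank ∘ inj₁

  next : Fin n₁ → Maybe (V n₁ n₂) → Fin n₁
  next _ (just (inj₁ j)) = j
  next i _               = i

  step : Fin n₁ → Fin n₁
  step i = next i (f₁ i)

  iterate : ℕ → Fin n₁ → Fin n₁
  iterate zero    i = i
  iterate (suc m) i = iterate m (step i)

  iterate-suc : ∀ m i → iterate (suc m) i ≡ step (iterate m i)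
  iterate-suc zero    i = refl
  iterate-suc (suc m) i = iterate-suc m (step i)

  iterate-fixed : ∀ m {i} → step i ≡ i → iterate m i ≡ i
  iterate-fixed zero    fixed = refl
  iterate-fixed (suc m) fixed rewrite fixed = iterate-fixed m fixed

  settles : ∀ m i → h i ≤ m → step (iterate m i) ≡ iterate m i
  settles m i h≤m with f₁ i in fi
  settles zero    i h≤0 | just (inj₁ j) = ⊥-elim (ℕ.n≮0 (ℕ.<-≤-trans (rank-decreasing fi) h≤0))
  settles (suc m) i h≤m | just (inj₁ j) =
    subst (λ i′ → step (iterate m i′) ≡ iterate m i′) (sym (cong (next i) fi))
          (settles m j (ℕ.≤-pred (ℕ.<-≤-trans (rank-decreasing fi) h≤m)))
  settles m       i h≤m | just (inj₂ _) rewrite iterate-fixed m (cong (next i) fi) = cong (next i) fi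
  settles m       i h≤m | nothing       rewrite iterate-fixed m (cong (next i) fi) = cong (next i) fi

  root : Fin n₁ → Fin n₁
  root = iterate L

  root-fixed : ∀ i → step (root i) ≡ root i
  root-fixed i = settles L i (rank≤ (inj₁ i))

  root-step : ∀ i → root (step i) ≡ root i
  root-step i = trans (iterate-suc L i) (root-fixed i)

  p : Fin n₁
  p = root u₀

  p-leaves-V₁ : ∀ {j} → f₁ p ≢ just (inj₁ j)
  p-leaves-V₁ fp≡j with trans (sym (cong (next p) fp≡j)) (root-fixed u₀)
  ... | refl = ℕ.n≮n (h p) (rank-decreasing fp≡j)

  root-of-fixed : ∀ {i} → step i ≡ i → i ≢ p → root i ≢ p
  root-of-fixed fixed i≢p root≡p = i≢p (trans (sym (iterate-fixed L fixed)) root≡p)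

  |f₂| : ℕ
  |f₂| = ∑ (𝟙 ∘ defined ∘ f ∘ inj₂)

  -- Receiving at p itself merely erases the arrow at p.
  receiver : V n₁ n₂ → Fin n₁
  receiver (inj₁ i) = i
  receiver (inj₂ _) = p

  receiver-undefined : ∀ y → f y ≡ nothing → receiver y ≢ p → f₁ (receiver y) ≡ nothing
  receiver-undefined (inj₁ i) fy≡nothing _   = fy≡nothing
  receiver-undefined (inj₂ _) _          z≢p = ⊥-elim (z≢p refl)

  receiver-slack : ∀ y → f y ≡ nothing → 𝟙 (defined (f₁ (receiver y))) + |f₂| ≤ n₂
  receiver-slack (inj₁ i) fy≡nothing rewrite fy≡nothing = ∑𝟙≤n (defined ∘ f ∘ inj₂)
  receiver-slack (inj₂ j) fy≡nothing =
    ℕ.≤-trans (ℕ.+-monoˡ-≤ |f₂| (𝟙≤1 _)) (∑𝟙<n (defined ∘ f ∘ inj₂) (cong defined fy≡nothing))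

  z : Fin n₁
  z = receiver dead

  γ : Fin n₁ → Maybe (V n₁ n₂)
  γ = reassign p z f₁

  γ-inner : ∀ {i j} → γ i ≡ just (inj₁ j) → f₁ i ≡ just (inj₁ j)
  γ-inner γi≡j with reassign-⊆ p z f₁ γi≡j
  ... | _ , inj₁ fi≡j       = fi≡j
  ... | _ , inj₂ (_ , fp≡j) = ⊥-elim (p-leaves-V₁ fp≡j)

  γ-outer : ∀ {i t} → γ i ≡ just (inj₂ t) → root i ≢ p
  γ-outer {i} γi≡t with reassign-⊆ p z f₁ γi≡t
  ... | i≢p , inj₁ fi≡t       = root-of-fixed (cong (next i) fi≡t) i≢p
  ... | i≢p , inj₂ (refl , _) = root-of-fixed (cong (next i) (receiver-undefined dead dead-undefined i≢p)) i≢p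

  β′ : V n₁ n₂ → Maybe (V n₁ n₂)
  β′ (inj₁ i) = γ i
  β′ (inj₂ _) = just (inj₁ u₀)

  β′-adjacent : ∀ v w → β′ v ≡ just w → JoinAdj Γ₁ Γ₂ w v
  β′-adjacent (inj₁ i) (inj₁ j) γi≡j = proj₂ α (inj₁ i) (inj₁ j) (γ-inner γi≡j)
  β′-adjacent (inj₁ i) (inj₂ t) _    = tt
  β′-adjacent (inj₂ j) w        refl = tt

  -- Arrows inside V₁ are arrows of α, so they lower h and keep the root; arrows into V₂ leave
  -- from outside the tree of p, which the penalty puts above the whole of V₂.
  penalty : Fin n₁ → ℕ
  penalty r = if does (r ≟ p) then 0 else suc (suc L)

  penalty≤ : ∀ r → penalty r ≤ suc (suc L)
  penalty≤ r with does (r ≟ p)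
  ... | true  = z≤n
  ... | false = ℕ.≤-refl

  β′-Rank : Rank β′ (L + suc (suc L))
  β′-Rank = record { rank = ρ ; rank≤ = ρ≤ ; rank-decreasing = λ {v} → ρ-decreasing {v} }
    where
    ρ : V n₁ n₂ → ℕ
    ρ (inj₁ i) = h i + penalty (root i)
    ρ (inj₂ _) = suc L

    ρ≤ : ∀ v → ρ v ≤ L + suc (suc L)
    ρ≤ (inj₁ i) = ℕ.+-mono-≤ (rank≤ (inj₁ i)) (penalty≤ (root i))
    ρ≤ (inj₂ _) = ℕ.≤-trans (ℕ.n≤1+n (suc L)) (ℕ.m≤n+m (suc (suc L)) L)

    ρ-decreasing : ∀ {v w} → β′ v ≡ just w → ρ w < ρ v
    ρ-decreasing {inj₂ _} refl rewrite dec-true (p ≟ p) refl =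
      s≤s (ℕ.≤-trans (ℕ.≤-reflexive (ℕ.+-identityʳ (h u₀))) (rank≤ (inj₁ u₀)))
    ρ-decreasing {inj₁ i} {inj₁ j} γi≡j =
      subst (λ q → h j + q < h i + penalty (root i)) (cong penalty same-root)
            (ℕ.+-monoˡ-< (penalty (root i)) (rank-decreasing fi≡j))
      where
      fi≡j = γ-inner γi≡j
      same-root : root i ≡ root j
      same-root = trans (sym (root-step i)) (cong (root ∘ next i) fi≡j)
    ρ-decreasing {inj₁ i} {inj₂ t} γi≡t rewrite dec-false (root i ≟ p) (γ-outer γi≡t) =
      ℕ.m≤n+m (suc (suc L)) (h i)

  |γ| : ℕ
  |γ| = ∑ (𝟙 ∘ defined ∘ γ)

  k≤n₂+|γ| : k ≤ n₂ + |γ|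
  k≤n₂+|γ| = begin
    k                                    ≡⟨ trans (sym |α|≡k) (count-vertices (defined ∘ f)) ⟩
    ∑ (𝟙 ∘ defined ∘ f₁) + |f₂|          ≡⟨ cong (_+ |f₂|) (∑-reassign p z f₁ defined refl) ⟨
    (|γ| + 𝟙 (defined (f₁ z))) + |f₂|    ≡⟨ ℕ.+-assoc |γ| _ |f₂| ⟩
    |γ| + (𝟙 (defined (f₁ z)) + |f₂|)    ≤⟨ ℕ.+-monoʳ-≤ |γ| (receiver-slack dead dead-undefined) ⟩
    |γ| + n₂                             ≡⟨ ℕ.+-comm |γ| n₂ ⟩
    n₂ + |γ|                             ∎
    where open ℕ.≤-Reasoning

  keep : V n₁ n₂ → Bool
  keep (inj₁ i) = selectFirst (k ∸ n₂) (defined ∘ γ) i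
  keep (inj₂ j) = selectFirst k (const true) j

  β : Animation Γ₁ Γ₂
  β = restrict keep β′ , λ v w βv≡w → β′-adjacent v w (restrict-⊆ keep β′ v βv≡w)

  defined-β : ∀ v → defined (proj₁ β v) ≡ keep v
  defined-β v = defined-restrict keep β′ v (kept⇒defined v)
    where
    kept⇒defined : ∀ v → keep v ≡ true → defined (β′ v) ≡ true
    kept⇒defined (inj₁ i) = selectFirst⇒ (k ∸ n₂) (defined ∘ γ) i
    kept⇒defined (inj₂ _) _ = refl

  |β₂| : ∑ (𝟙 ∘ defined ∘ proj₁ β ∘ inj₂) ≡ k ⊓ n₂
  |β₂| = begin
    ∑ (𝟙 ∘ defined ∘ proj₁ β ∘ inj₂)             ≡⟨ sum-cong-≗ (cong 𝟙 ∘ defined-β ∘ inj₂) ⟩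
    ∑ (𝟙 ∘ selectFirst k {n₂} (const true))      ≡⟨ ∑-selectFirst k {n₂} (const true) ⟩
    k ⊓ ∑ {n₂} (const 1)                         ≡⟨ cong (k ⊓_) (∑-ones n₂) ⟩
    k ⊓ n₂                                       ∎
    where open ≡-Reasoning

  β-size : domSize β ≡ k
  β-size = begin
    domSize β
      ≡⟨ count-vertices (defined ∘ proj₁ β) ⟩
    ∑ (𝟙 ∘ defined ∘ proj₁ β ∘ inj₁) + ∑ (𝟙 ∘ defined ∘ proj₁ β ∘ inj₂)
      ≡⟨ cong₂ _+_ (sum-cong-≗ (cong 𝟙 ∘ defined-β ∘ inj₁)) |β₂| ⟩
    ∑ (𝟙 ∘ selectFirst (k ∸ n₂) (defined ∘ γ)) + k ⊓ n₂
      ≡⟨ cong (_+ k ⊓ n₂) (∑-selectFirst (k ∸ n₂) (defined ∘ γ)) ⟩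
    (k ∸ n₂) ⊓ |γ| + k ⊓ n₂
      ≡⟨ cong (_+ k ⊓ n₂) (ℕ.m≤n⇒m⊓n≡m (ℕ.m≤n+o⇒m∸n≤o k n₂ k≤n₂+|γ|)) ⟩
    (k ∸ n₂) + k ⊓ n₂
      ≡⟨ trans (ℕ.+-comm (k ∸ n₂) _) (cong (_+ (k ∸ n₂)) (ℕ.⊓-comm k n₂)) ⟩
    n₂ ⊓ k + (k ∸ n₂)
      ≡⟨ ℕ.m⊓n+n∸m≡n n₂ k ⟩
    k ∎
    where open ≡-Reasoning

  β-nilpotent : Nil Γ₁ Γ₂ k β
  β-nilpotent = (suc (L + suc (suc L)) , s≤s z≤n , Rank⇒nowhereDefined (proj₁ β) β-Rank) , β-size
    where
    β-Rank : Rank (proj₁ β) (L + suc (suc L))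
    β-Rank = Rank-⊆ β′ (λ {v} → restrict-⊆ keep β′ v) β′-Rank

  β-centred : Centred (inj₁ u₀) k β
  β-centred = trans (count-allFin (defined ∘ proj₁ β ∘ inj₂)) |β₂| ,
              λ v w βv≡w → sym (just-injective (restrict-⊆ keep β′ (inj₂ v) βv≡w))

  β-below : mon β ≤ᶜ[ inj₁ u₀ ] mon α
  β-below w w≢u = begin
    mon β w                                           ≡⟨ count-vertices (hits w ∘ proj₁ β) ⟩
    ∑V (𝟙 ∘ hits w ∘ restrict keep β′)                ≤⟨ ∑V-mono-≤ (restrict-≤ keep β′ (hits w) refl) ⟩
    ∑ (𝟙 ∘ hits w ∘ γ) + ∑ {n₂} (const (𝟙 (hits w (just (inj₁ u₀)))))
                                                      ≡⟨ cong (∑ (𝟙 ∘ hits w ∘ γ) +_) (∑-zero {n₂} λ _ → cong 𝟙 misses-u) ⟩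
    ∑ (𝟙 ∘ hits w ∘ γ) + 0                            ≤⟨ ℕ.+-monoʳ-≤ (∑ (𝟙 ∘ hits w ∘ γ)) z≤n ⟩
    ∑ (𝟙 ∘ hits w ∘ γ) + 𝟙 (hits w (f₁ z))            ≡⟨ ∑-reassign p z f₁ (hits w) refl ⟩
    ∑ (𝟙 ∘ hits w ∘ f₁)                               ≤⟨ ℕ.m≤m+n _ _ ⟩
    ∑V (𝟙 ∘ hits w ∘ f)                               ≡⟨ count-vertices (hits w ∘ f) ⟨
    mon α w                                           ∎
    where
    open ℕ.≤-Reasoning
    misses-u : hits w (just (inj₁ u₀)) ≡ false
    misses-u = trans (hits-just w (inj₁ u₀)) (dec-false (inj₁ u₀ ≟V w) (w≢u ∘ sym))

centredAtV₁ : ∀ {n₁ n₂} {Γ₁ : Graph n₁} {Γ₂ : Graph n₂} (u₀ : Fin n₁) (k : ℕ) (α : Animation Γ₁ Γ₂) →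
  Nil Γ₁ Γ₂ k α → Σ (Animation Γ₁ Γ₂) λ β → Nil Γ₁ Γ₂ k β × Centred (inj₁ u₀) k β × mon β ≤ᶜ[ inj₁ u₀ ] mon α
centredAtV₁ u₀ k α ((suc M , _ , nilpotent) , |α|≡k) = β , β-nilpotent , β-centred , β-below
  where
  dead = dies-somewhere (proj₁ α) (suc M) (inj₁ u₀) (nilpotent (inj₁ u₀))
  open CentredAtV₁ α (nowhereDefined⇒Rank (proj₁ α) {M} nilpotent) (proj₁ dead) (proj₂ dead) u₀ k |α|≡k

defined-map-swap : ∀ {A B : Set} (m : Maybe (A ⊎ B)) → defined (Maybe.map swap m) ≡ defined m
defined-map-swap nothing  = refl
defined-map-swap (just _) = refl

module _ {n₁ n₂} {Γ₁ : Graph n₁} {Γ₂ : Graph n₂} where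

  JoinAdj-swap : ∀ y x → JoinAdj Γ₁ Γ₂ y (swap x) → JoinAdj Γ₂ Γ₁ (swap y) x
  JoinAdj-swap (inj₁ _) (inj₁ _) adj = adj
  JoinAdj-swap (inj₁ _) (inj₂ _) adj = adj
  JoinAdj-swap (inj₂ _) (inj₁ _) adj = adj
  JoinAdj-swap (inj₂ _) (inj₂ _) adj = adj

  swapAnimation : Animation Γ₁ Γ₂ → Animation Γ₂ Γ₁
  swapAnimation (g , adjacent) = Maybe.map swap ∘ g ∘ swap , adjacent′
    where
    adjacent′ : ∀ v w → Maybe.map swap (g (swap v)) ≡ just w → JoinAdj Γ₂ Γ₁ w v
    adjacent′ v w gv≡w with g (swap v) in gv≡y
    adjacent′ v _ refl | just y = JoinAdj-swap y v (adjacent (swap v) y gv≡y)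

  hits-map-swap : ∀ w (m : Maybe (V n₁ n₂)) → hits w (Maybe.map swap m) ≡ hits (swap w) m
  hits-map-swap w nothing  = refl
  hits-map-swap w (just y) rewrite hits-just w (swap y) | hits-just (swap w) y with y ≟V swap w
  ... | yes refl  = dec-true (swap (swap w) ≟V w) (swap-involutive w)
  ... | no  y≢w′ = dec-false (swap y ≟V w) (λ y′≡w → y≢w′ (trans (sym (swap-involutive y)) (cong swap y′≡w)))

  iter-swap : ∀ (g : V n₁ n₂ → Maybe (V n₁ n₂)) m v →
              iter (Maybe.map swap ∘ g ∘ swap) m v ≡ Maybe.map swap (iter g m (swap v))
  iter-swap g zero    v = cong just (sym (swap-involutive v))
  iter-swap g (suc m) v rewrite iter-swap g m v with iter g m (swap v)
  ... | nothing = refl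
  ... | just y rewrite swap-involutive y = refl

  domSize-swap : (γ : Animation Γ₁ Γ₂) → domSize (swapAnimation γ) ≡ domSize γ
  domSize-swap γ = begin
    domSize (swapAnimation γ)                       ≡⟨ count-vertices (defined ∘ proj₁ (swapAnimation γ)) ⟩
    ∑V (𝟙 ∘ defined ∘ Maybe.map swap ∘ g ∘ swap)    ≡⟨ ∑V-cong (cong 𝟙 ∘ defined-map-swap ∘ g ∘ swap) ⟩
    ∑V (𝟙 ∘ defined ∘ g ∘ swap)                     ≡⟨ ∑V-swap (𝟙 ∘ defined ∘ g) ⟩
    ∑V (𝟙 ∘ defined ∘ g)                            ≡⟨ count-vertices (defined ∘ g) ⟨
    domSize γ                                       ∎
    where
    open ≡-Reasoning
    g = proj₁ γ

  mon-swap : (γ : Animation Γ₁ Γ₂) → ∀ w → mon (swapAnimation γ) w ≡ mon γ (swap w)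
  mon-swap γ w = begin
    mon (swapAnimation γ) w                         ≡⟨ count-vertices (hits w ∘ proj₁ (swapAnimation γ)) ⟩
    ∑V (𝟙 ∘ hits w ∘ Maybe.map swap ∘ g ∘ swap)     ≡⟨ ∑V-cong (cong 𝟙 ∘ hits-map-swap w ∘ g ∘ swap) ⟩
    ∑V (𝟙 ∘ hits (swap w) ∘ g ∘ swap)               ≡⟨ ∑V-swap (𝟙 ∘ hits (swap w) ∘ g) ⟩
    ∑V (𝟙 ∘ hits (swap w) ∘ g)                      ≡⟨ count-vertices (hits (swap w) ∘ g) ⟨
    mon γ (swap w)                                  ∎
    where
    open ≡-Reasoning
    g = proj₁ γ

  Nil-swap : ∀ {k} (γ : Animation Γ₁ Γ₂) → Nil Γ₁ Γ₂ k γ → Nil Γ₂ Γ₁ k (swapAnimation γ)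
  Nil-swap γ ((m , 1≤m , nilpotent) , |γ|≡k) =
    (m , 1≤m , λ v → trans (iter-swap (proj₁ γ) m v) (cong (Maybe.map swap) (nilpotent (swap v)))) ,
    trans (domSize-swap γ) |γ|≡k

Centred-swap : ∀ {n₁ n₂} {Γ₁ : Graph n₁} {Γ₂ : Graph n₂} {k} (u₀ : Fin n₂) (γ : Animation Γ₂ Γ₁) → Centred (inj₁ u₀) k γ → Centred (inj₂ u₀) k (swapAnimation γ)
Centred-swap {n₁} {k = k} u₀ (g , _) (|γ₂| , γ₂-targets) = |γ₂|′ , γ₂-targets′
  where
  |γ₂|′ : count (λ v → defined (Maybe.map swap (g (inj₂ v)))) (allFin n₁) ≡ k ⊓ n₁
  |γ₂|′ = begin
    count (λ v → defined (Maybe.map swap (g (inj₂ v)))) (allFin n₁)  ≡⟨ count-allFin (λ v → defined (Maybe.map swap (g (inj₂ v)))) ⟩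
    ∑ (𝟙 ∘ defined ∘ Maybe.map swap ∘ g ∘ inj₂)                      ≡⟨ sum-cong-≗ (cong 𝟙 ∘ defined-map-swap ∘ g ∘ inj₂) ⟩
    ∑ (𝟙 ∘ defined ∘ g ∘ inj₂)                                       ≡⟨ count-allFin (defined ∘ g ∘ inj₂) ⟨
    count (defined ∘ g ∘ inj₂) (allFin n₁)                           ≡⟨ |γ₂| ⟩
    k ⊓ n₁                                                           ∎
    where open ≡-Reasoning
  γ₂-targets′ : ∀ v w → Maybe.map swap (g (inj₂ v)) ≡ just w → w ≡ inj₂ u₀
  γ₂-targets′ v w gv≡w with g (inj₂ v) in gv≡y
  γ₂-targets′ v _ refl | just y = cong swap (γ₂-targets v y gv≡y)

below-swap : ∀ {n₁ n₂} {Γ₁ : Graph n₁} {Γ₂ : Graph n₂} {u₀ : Fin n₂} (β : Animation Γ₂ Γ₁) (α : Animation Γ₁ Γ₂) →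
             mon β ≤ᶜ[ inj₁ u₀ ] mon (swapAnimation α) → mon (swapAnimation β) ≤ᶜ[ inj₂ u₀ ] mon α
below-swap β α β≤α w w≢u = begin
  mon (swapAnimation β) w          ≡⟨ mon-swap β w ⟩
  mon β (swap w)                   ≤⟨ β≤α (swap w) (λ w′≡u → w≢u (trans (sym (swap-involutive w)) (cong swap w′≡u))) ⟩
  mon (swapAnimation α) (swap w)   ≡⟨ trans (mon-swap α (swap w)) (cong (mon α) (swap-involutive w)) ⟩
  mon α w                          ∎
  where open ℕ.≤-Reasoning

centredReplacement : ∀ {n₁ n₂} {Γ₁ : Graph n₁} {Γ₂ : Graph n₂} (u : V n₁ n₂) (k : ℕ) (α : Animation Γ₁ Γ₂) →
  Nil Γ₁ Γ₂ k α → Σ (Animation Γ₁ Γ₂) λ β → Nil Γ₁ Γ₂ k β × Centred u k β × mon β ≤ᶜ[ u ] mon α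
centredReplacement (inj₁ u₀) k α α-nil = centredAtV₁ u₀ k α α-nil
centredReplacement (inj₂ u₀) k α α-nil with centredAtV₁ u₀ k (swapAnimation α) (Nil-swap α α-nil)
... | β , β-nil , β-centred , β-below =
  swapAnimation β , Nil-swap β β-nil , Centred-swap u₀ β β-centred , below-swap β α β-below

theorem9p3 : ∀ {n₁ n₂} (Γ₁ : Graph n₁) (Γ₂ : Graph n₂) →
    Loopless Γ₁ → Loopless Γ₂ → 1 ≤ n₁ → 1 ≤ n₂ →
    (u : V n₁ n₂) (k : ℕ) (α : Animation Γ₁ Γ₂) → Nil Γ₁ Γ₂ k α →
    Σ (Animation Γ₁ Γ₂) (λ β →
    Nil Γ₁ Γ₂ k β × Centred u k β × (mon β ≼[ u ] mon α))
theorem9p3 Γ₁ Γ₂ _ _ _ _ u k α α-nil with centredReplacement u k α α-nil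
... | β , β-nil , β-centred , β-below = β , β-nil , β-centred , ≼-intro β-below same-total
  where
  same-total : List.sum (map (mon β) (vertices _ _)) ≡ List.sum (map (mon α) (vertices _ _))
  same-total = trans (sum-mon≡domSize β) (trans (proj₂ β-nil) (sym (trans (sum-mon≡domSize α) (proj₂ α-nil))))
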